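{- Let $G$ be a generalized geodetic graph and $H$ a graph such that $\mathrm{sg}(G \,\square\, H) = \mathrm{sg}(G)$. If $S$ is an sg-set of $G \,\square\, H$, then $|p_G(S)| = |S|$ and $p_G(S)$ is an sg-set of $G$.
   Context: Graphs are finite and simple; strong geodetic notions are considered for connected graphs. $G\,\square\,H$ is the Cartesian product: vertex set $V(G)\times V(H)$, with $(g,h)\sim(g',h')$ iff either $g=g'$ and $hh'\in E(H)$, or $h=h'$ and $gg'\in E(G)$. For $X\subseteq V(G\,\square\,H)$, $p_G(X)=\{g: (g,h)\in X \text{ for some } h\}$. For $S\subseteq V(G)$, $S$ is a strong geodetic set if one can fix, for each unordered pair of distinct $x,y\in S$, a single shortest $x,y$-path so that the union of the vertex sets of the chosen paths is $V(G)$; $\mathrm{sg}(G)$ is the minimum size of a strong geodetic set and an sg-set is a strong geodetic set of size $\mathrm{sg}(G)$. The interval $I_G(u,v)$ is the set of vertices lying on some shortest $u,v$-path; the geodetic number $\mathrm{g}(G)$ is the minimum size of $S\subseteq V(G)$ with $\bigcup_{\{u,v\}\subseteq S} I_G(u,v)=V(G)$. A graph $G$ is generalized geodetic if $\mathrm{g}(G)=\mathrm{sg}(G)$. -}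

module Defs where

open import Data.Nat using (ℕ; _≤_; _<_)
open import Data.Fin as Fin using (Fin; combine; remQuot)
open import Data.Fin.Subset using (Subset; _∈_; ∣_∣)
open import Data.Fin.Subset.Properties using (_∈?_)
open import Data.Fin.Properties using (any?)
open import Data.Vec using (tabulate)
open import Data.List using (List; []; _∷_; length)
import Data.List.Membership.Propositional as LM
open import Data.Product using (Σ; ∃; _×_; _,_; proj₁; proj₂)
open import Data.Sum using (_⊎_)
open import Relation.Binary.PropositionalEquality using (_≡_; _≢_)
open import Relation.Nullary using (¬_; does)

record Graph : Set₁ where
  field
    n   : ℕ
    Adj : Fin n → Fin n → Set
open Graph public

V : Graph → Set
V G = Fin (n G)

IsSimple : Graph → Set
IsSimple G = (∀ u v → Adj G u v → Adj G v u) × (∀ u → ¬ Adj G u u)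

-- IsPath G p u v : the vertex list p is a walk from u to v
-- (consecutive vertices adjacent); its length is  length p - 1.
data IsPath (G : Graph) : List (V G) → V G → V G → Set where
  single : ∀ {u} → IsPath G (u ∷ []) u u
  step   : ∀ {u w v p} → Adj G u w → IsPath G p w v → IsPath G (u ∷ p) u v

Connected : Graph → Set
Connected G = V G × (∀ u v → ∃ λ p → IsPath G p u v)

-- p is a shortest u,v-path (a walk of minimum length is automatically a path).
IsGeodesic : (G : Graph) → List (V G) → V G → V G → Set
IsGeodesic G p u v = IsPath G p u v × (∀ q → IsPath G q u v → length p ≤ length q)

InInterval : (G : Graph) → V G → V G → V G → Set
InInterval G w u v = ∃ λ p → IsGeodesic G p u v × LM._∈_ w p

-- Geodetic set: every vertex lies in I(u,v) for some u,v ∈ S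
-- (u = v allowed, so that I(u,u) = {u}).
IsGeodeticSet : (G : Graph) → Subset (n G) → Set
IsGeodeticSet G S =
  ∀ w → ∃ λ u → ∃ λ v → u ∈ S × v ∈ S × InInterval G w u v

-- Strong geodetic set: a choice of one shortest path P x y for each
-- unordered pair {x,y} ⊆ S (represented by x < y) such that the vertices of S
-- together with the vertices of the chosen paths cover V(G).
IsStrongGeodeticSet : (G : Graph) → Subset (n G) → Set
IsStrongGeodeticSet G S =
  Σ (V G → V G → List (V G)) λ P →
    (∀ x y → x ∈ S → y ∈ S → x Fin.< y → IsGeodesic G (P x y) x y) ×
    (∀ w → w ∈ S ⊎ (∃ λ x → ∃ λ y → x ∈ S × y ∈ S × x Fin.< y × LM._∈_ w (P x y)))

IsSgSet : (G : Graph) → Subset (n G) → Set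
IsSgSet G S = IsStrongGeodeticSet G S × (∀ T → IsStrongGeodeticSet G T → ∣ S ∣ ≤ ∣ T ∣)

SgNumber : Graph → ℕ → Set
SgNumber G k = ∃ λ S → IsSgSet G S × ∣ S ∣ ≡ k

GeodeticNumber : Graph → ℕ → Set
GeodeticNumber G k =
  ∃ λ S → IsGeodeticSet G S × ∣ S ∣ ≡ k × (∀ T → IsGeodeticSet G T → k ≤ ∣ T ∣)

GeneralizedGeodetic : Graph → Set
GeneralizedGeodetic G = ∃ λ k → GeodeticNumber G k × SgNumber G k

-- Cartesian product G □ H; vertex (g,h) is encoded as  combine g h : Fin (n G * n H).
_□_ : Graph → Graph → Graph
G □ H = record
  { n   = n G Data.Nat.* n H
  ; Adj = λ a b →
      let g  = proj₁ (remQuot {n G} (n H) a) ; h  = proj₂ (remQuot {n G} (n H) a)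
          g' = proj₁ (remQuot {n G} (n H) b) ; h' = proj₂ (remQuot {n G} (n H) b)
      in (g ≡ g' × Adj H h h') ⊎ (h ≡ h' × Adj G g g')
  }

projG : (G H : Graph) → Subset (n (G □ H)) → Subset (n G)
projG G H X = tabulate λ g → does (any? λ h → combine {n G} {n H} g h ∈? X)

module Submission where

-- Proposition 6.4.  Let π₁ : V(G □ H) → V(G) be the first coordinate and let
-- k = sg(G □ H) = sg(G) = g(G).
--  (1) Contracting a walk of G □ H along π₁ (map π₁, then merge consecutive
--      repeats) gives a walk of G.  The π₁- and π₂-shadows of a walk have
--      total length at most one more than the walk, and conversely a walk of G
--      and a walk of H lift to a walk of G □ H of that total length; hence the
--      π₁-shadow of a geodesic of G □ H is a geodesic of G.
--  (2) For a strong geodetic set S of G □ H and a vertex h₀ of H, the layer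
--      G × {h₀} is covered by the chosen geodesics, so by (1) p_G(S) is a
--      geodetic set of G and k = g(G) ≤ |p_G(S)|.
--  (3) |p_G(S)| ≤ |S|, strictly if π₁ identifies two vertices of S.  For an
--      sg-set S we get k ≤ |p_G(S)| ≤ |S| = k, so π₁ is injective on S.
--  (4) If π₁ is injective on a strong geodetic set S, each pair of p_G(S) has
--      a unique preimage pair in S, and contracting its chosen geodesic as in
--      (1) makes p_G(S) strong geodetic in G; having size k = sg(G) it is an
--      sg-set.

open import Defs
open import Data.Fin.Subset using (Subset; ∣_∣)
open import Data.Product using (_×_; ∃)
open import Relation.Binary.PropositionalEquality using (_≡_)

open import Data.Empty using (⊥-elim)
open import Data.Fin using (Fin; zero; suc; combine; remQuot)
open import Data.Fin.Properties using (any?; _≟_; <-cmp; <-asym; <⇒≢; combine-monoˡ-<; remQuot-combine; combine-remQuot)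
import Data.Fin as Fin
open import Data.Fin.Subset using (inside; outside; _∈_; _⊆_) renaming (⊥ to ∅)
open import Data.Fin.Subset.Properties using (_∈?_; ∣⊥∣≡0; p⊆q⇒∣p∣≤∣q∣)
open import Data.List using (List; []; _∷_; length)
open import Data.List.Membership.Propositional using () renaming (_∈_ to _∈ₗ_)
open import Data.List.Relation.Unary.Any using (here; there)
open import Data.Nat using (ℕ; suc; _+_; _≤_; _<_; z≤n; s≤s)
open import Data.Nat.Properties using (≤-refl; ≤-trans; ≤-reflexive; ≤-antisym; n≤1+n; m≤n⇒m≤1+n; +-suc; +-cancelʳ-≤; <-irrefl; ≤-<-trans; module ≤-Reasoning)
open import Data.Product using (_,_; proj₁; proj₂)
open import Data.Sum using (_⊎_; inj₁; inj₂)
open import Data.Vec using ([]; _∷_; here; there)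
open import Data.Vec.Properties using (lookup∘tabulate; lookup⇒[]=; []=⇒lookup)
open import Function using (_∘_)
open import Relation.Binary.Definitions using (tri<; tri≈; tri>)
open import Relation.Binary.PropositionalEquality using (refl; sym; trans; cong; subst; subst₂; _≢_)
open import Relation.Nullary using (Dec; yes; no)
open import Relation.Nullary.Decidable using (dec-true)

insert : ∀ {n} → Fin n → Subset n → Subset n
insert zero    (_ ∷ q) = inside ∷ q
insert (suc x) (b ∷ q) = b ∷ insert x q

∣insert∣≤ : ∀ {n} (x : Fin n) (q : Subset n) → ∣ insert x q ∣ ≤ suc ∣ q ∣
∣insert∣≤ zero    (inside  ∷ q) = n≤1+n _
∣insert∣≤ zero    (outside ∷ q) = ≤-refl
∣insert∣≤ (suc x) (inside  ∷ q) = s≤s (∣insert∣≤ x q)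
∣insert∣≤ (suc x) (outside ∷ q) = ∣insert∣≤ x q

insert-∈ : ∀ {n} {x : Fin n} {q : Subset n} → x ∈ q → insert x q ≡ q
insert-∈ {q = _ ∷ _} here        = refl
insert-∈ {q = b ∷ _} (there x∈q) = cong (b ∷_) (insert-∈ x∈q)

∈-insert : ∀ {n} (x : Fin n) (q : Subset n) → x ∈ insert x q
∈-insert zero    (_ ∷ q) = here
∈-insert (suc x) (_ ∷ q) = there (∈-insert x q)

∈-insert⁺ : ∀ {n} (x : Fin n) {y : Fin n} {q : Subset n} → y ∈ q → y ∈ insert x q
∈-insert⁺ zero    {zero}  here        = here
∈-insert⁺ zero    {suc y} (there y∈q) = there y∈q
∈-insert⁺ (suc x) {zero}  here        = here
∈-insert⁺ (suc x) {suc y} (there y∈q) = there (∈-insert⁺ x y∈q)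

image : ∀ {N M} → (Fin N → Fin M) → Subset N → Subset M
image f []            = ∅
image f (inside  ∷ S) = insert (f zero) (image (f ∘ suc) S)
image f (outside ∷ S) = image (f ∘ suc) S

∈-image : ∀ {N M} (f : Fin N → Fin M) (S : Subset N) {x : Fin N} → x ∈ S → f x ∈ image f S
∈-image f (inside  ∷ S) here        = ∈-insert (f zero) (image (f ∘ suc) S)
∈-image f (inside  ∷ S) (there x∈S) = ∈-insert⁺ (f zero) (∈-image (f ∘ suc) S x∈S)
∈-image f (outside ∷ S) (there x∈S) = ∈-image (f ∘ suc) S x∈S

∣image∣≤ : ∀ {N M} (f : Fin N → Fin M) (S : Subset N) → ∣ image f S ∣ ≤ ∣ S ∣
∣image∣≤ {M = M} f [] = ≤-reflexive (∣⊥∣≡0 M)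
∣image∣≤ f (inside  ∷ S) = ≤-trans (∣insert∣≤ (f zero) (image (f ∘ suc) S)) (s≤s (∣image∣≤ (f ∘ suc) S))
∣image∣≤ f (outside ∷ S) = ∣image∣≤ (f ∘ suc) S

∣image∣<-repeatedHead : ∀ {N M} (f : Fin (suc N) → Fin M) (S : Subset N) →
                        f zero ∈ image (f ∘ suc) S → ∣ image f (inside ∷ S) ∣ < suc ∣ S ∣
∣image∣<-repeatedHead f S repeated rewrite insert-∈ repeated = s≤s (∣image∣≤ (f ∘ suc) S)

∣image∣< : ∀ {N M} (f : Fin N → Fin M) (S : Subset N) {x y : Fin N} →
           x ∈ S → y ∈ S → x ≢ y → f x ≡ f y → ∣ image f S ∣ < ∣ S ∣
∣image∣< f (inside ∷ S) here here x≢y _ = ⊥-elim (x≢y refl)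
∣image∣< f (inside ∷ S) here (there y∈S) _ fx≡fy =
  ∣image∣<-repeatedHead f S (subst (_∈ image (f ∘ suc) S) (sym fx≡fy) (∈-image (f ∘ suc) S y∈S))
∣image∣< f (inside ∷ S) (there x∈S) here _ fx≡fy =
  ∣image∣<-repeatedHead f S (subst (_∈ image (f ∘ suc) S) fx≡fy (∈-image (f ∘ suc) S x∈S))
∣image∣< f (inside ∷ S) (there x∈S) (there y∈S) x≢y fx≡fy =
  s≤s (≤-trans (∣insert∣≤ (f zero) (image (f ∘ suc) S))
               (∣image∣< (f ∘ suc) S x∈S y∈S (x≢y ∘ cong suc) fx≡fy))
∣image∣< f (outside ∷ S) (there x∈S) (there y∈S) x≢y fx≡fy =
  ∣image∣< (f ∘ suc) S x∈S y∈S (x≢y ∘ cong suc) fx≡fy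

InjectiveOn : ∀ {N M} → (Fin N → Fin M) → Subset N → Set
InjectiveOn f S = ∀ {x y} → x ∈ S → y ∈ S → f x ≡ f y → x ≡ y

full-image⇒injective : ∀ {N M} (f : Fin N → Fin M) (S : Subset N) →
                       ∣ S ∣ ≤ ∣ image f S ∣ → InjectiveOn f S
full-image⇒injective f S full {x} {y} x∈S y∈S fx≡fy with x ≟ y
... | yes x≡y = x≡y
... | no  x≢y = ⊥-elim (<-irrefl refl (≤-<-trans full (∣image∣< f S x∈S y∈S x≢y fx≡fy)))

consUnless : ∀ {A B : Set} {a b : A} → Dec (a ≡ b) → B → List B → List B
consUnless (yes _) x l = l
consUnless (no _)  x l = x ∷ l

contract : ∀ {A : Set} {m} → (A → Fin m) → List A → List (Fin m)
contract f []          = []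
contract f (x ∷ [])    = f x ∷ []
contract f (x ∷ y ∷ l) = consUnless (f x ≟ f y) (f x) (contract f (y ∷ l))

∈-consUnless⁺ : ∀ {A B : Set} {a b : A} (d : Dec (a ≡ b)) (x : B) {t : B} {l : List B} →
                t ∈ₗ l → t ∈ₗ consUnless d x l
∈-consUnless⁺ (yes _) x t∈l = t∈l
∈-consUnless⁺ (no _)  x t∈l = there t∈l

head-∈-contract : ∀ {A : Set} {m} (f : A → Fin m) (x : A) (l : List A) → f x ∈ₗ contract f (x ∷ l)
head-∈-contract f x []      = here refl
head-∈-contract f x (y ∷ l) with f x ≟ f y
... | yes fx≡fy = subst (_∈ₗ contract f (y ∷ l)) (sym fx≡fy) (head-∈-contract f y l)
... | no  _     = here refl

∈-contract : ∀ {A : Set} {m} (f : A → Fin m) {x : A} (l : List A) → x ∈ₗ l → f x ∈ₗ contract f l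
∈-contract f (x ∷ l)     (here refl) = head-∈-contract f x l
∈-contract f (y ∷ z ∷ l) (there x∈l) = ∈-consUnless⁺ (f y ≟ f z) (f y) (∈-contract f (z ∷ l) x∈l)

module WeakHomomorphism (L K : Graph) (f : V L → V K)
         (edge : ∀ {a b} → Adj L a b → f a ≡ f b ⊎ Adj K (f a) (f b)) where

  private
    consUnless-isPath : ∀ {a b v l} → f a ≡ f b ⊎ Adj K (f a) (f b) → (d : Dec (f a ≡ f b)) →
                        IsPath K l (f b) v → IsPath K (consUnless d (f a) l) (f a) v
    consUnless-isPath _                (yes fa≡fb) walk = subst (λ z → IsPath K _ z _) (sym fa≡fb) walk
    consUnless-isPath (inj₁ fa≡fb)     (no fa≢fb)  walk = ⊥-elim (fa≢fb fa≡fb)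
    consUnless-isPath (inj₂ fa~fb)     (no _)      walk = step fa~fb walk

  -- The tail walk is split by constructor so that its first vertex is exposed
  -- and contract f (a ∷ tail) unfolds to a consUnless.
  contract-isPath : ∀ {p a b} → IsPath L p a b → IsPath K (contract f p) (f a) (f b)
  contract-isPath single = single
  contract-isPath (step {a} {b} a~b rest@single) =
    consUnless-isPath (edge a~b) (f a ≟ f b) (contract-isPath rest)
  contract-isPath (step {a} {b} a~b rest@(step _ _)) =
    consUnless-isPath (edge a~b) (f a ≟ f b) (contract-isPath rest)

module ComplementaryContractions (L : Graph) {m₁ m₂ : ℕ} (f₁ : V L → Fin m₁) (f₂ : V L → Fin m₂)
         (edge : ∀ {a b} → Adj L a b → f₁ a ≡ f₁ b ⊎ f₂ a ≡ f₂ b) where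

  private
    -- one step of the walk adds a vertex to at most one of the contractions
    consUnless-length : ∀ {a b : V L} {l₁ : List (Fin m₁)} {l₂ : List (Fin m₂)} {k : ℕ} →
                        f₁ a ≡ f₁ b ⊎ f₂ a ≡ f₂ b →
                        (d₁ : Dec (f₁ a ≡ f₁ b)) (d₂ : Dec (f₂ a ≡ f₂ b)) →
                        length l₁ + length l₂ ≤ k →
                        length (consUnless d₁ (f₁ a) l₁) + length (consUnless d₂ (f₂ a) l₂) ≤ suc k
    consUnless-length _            (yes _)  (yes _)  le = m≤n⇒m≤1+n le
    consUnless-length _            (yes _)  (no _)   le = ≤-trans (≤-reflexive (+-suc _ _)) (s≤s le)
    consUnless-length _            (no _)   (yes _)  le = s≤s le
    consUnless-length (inj₁ equal) (no ne)  (no _)   le = ⊥-elim (ne equal)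
    consUnless-length (inj₂ equal) (no _)   (no ne)  le = ⊥-elim (ne equal)

  contract-length : ∀ {p a b} → IsPath L p a b →
                    length (contract f₁ p) + length (contract f₂ p) ≤ suc (length p)
  contract-length single = ≤-refl
  contract-length (step {a} {b} a~b rest@single) =
    consUnless-length (edge a~b) (f₁ a ≟ f₁ b) (f₂ a ≟ f₂ b) (contract-length rest)
  contract-length (step {a} {b} a~b rest@(step _ _)) =
    consUnless-length (edge a~b) (f₁ a ≟ f₁ b) (f₂ a ≟ f₂ b) (contract-length rest)

trivial-geodesic : ∀ {K : Graph} (w : V K) → IsGeodesic K (w ∷ []) w w
trivial-geodesic w = single , λ { _ single → s≤s z≤n ; _ (step _ _) → s≤s z≤n }

module Product (G H : Graph) where

  π₁ : V (G □ H) → V G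
  π₁ a = proj₁ (remQuot {n G} (n H) a)

  π₂ : V (G □ H) → V H
  π₂ a = proj₂ (remQuot {n G} (n H) a)

  ⟨_,_⟩ : V G → V H → V (G □ H)
  ⟨ g , h ⟩ = combine {n G} {n H} g h

  π₁-⟨⟩ : ∀ g h → π₁ ⟨ g , h ⟩ ≡ g
  π₁-⟨⟩ g h = cong proj₁ (remQuot-combine g h)

  π₂-⟨⟩ : ∀ g h → π₂ ⟨ g , h ⟩ ≡ h
  π₂-⟨⟩ g h = cong proj₂ (remQuot-combine g h)

  ⟨π₁,π₂⟩ : ∀ a → ⟨ π₁ a , π₂ a ⟩ ≡ a
  ⟨π₁,π₂⟩ a = combine-remQuot {n G} (n H) a

  -- The encoding is lexicographic with G first.
  π₁-<⇒< : ∀ {a b} → π₁ a Fin.< π₁ b → a Fin.< b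
  π₁-<⇒< {a} {b} lt = subst₂ Fin._<_ (⟨π₁,π₂⟩ a) (⟨π₁,π₂⟩ b) (combine-monoˡ-< (π₂ a) (π₂ b) lt)

  π₁-edge : ∀ {a b} → Adj (G □ H) a b → π₁ a ≡ π₁ b ⊎ Adj G (π₁ a) (π₁ b)
  π₁-edge (inj₁ (same , _)) = inj₁ same
  π₁-edge (inj₂ (_ , g~g')) = inj₂ g~g'

  π₂-edge : ∀ {a b} → Adj (G □ H) a b → π₂ a ≡ π₂ b ⊎ Adj H (π₂ a) (π₂ b)
  π₂-edge (inj₁ (_ , h~h')) = inj₂ h~h'
  π₂-edge (inj₂ (same , _)) = inj₁ same

  edge-fixes-a-coordinate : ∀ {a b} → Adj (G □ H) a b → π₁ a ≡ π₁ b ⊎ π₂ a ≡ π₂ b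
  edge-fixes-a-coordinate (inj₁ (same , _)) = inj₁ same
  edge-fixes-a-coordinate (inj₂ (same , _)) = inj₂ same

  fibre-edge : ∀ g {h h'} → Adj H h h' → Adj (G □ H) ⟨ g , h ⟩ ⟨ g , h' ⟩
  fibre-edge g {h} {h'} h~h' =
    inj₁ (trans (π₁-⟨⟩ g h) (sym (π₁-⟨⟩ g h')) , subst₂ (Adj H) (sym (π₂-⟨⟩ g h)) (sym (π₂-⟨⟩ g h')) h~h')

  layer-edge : ∀ {g g'} h → Adj G g g' → Adj (G □ H) ⟨ g , h ⟩ ⟨ g' , h ⟩
  layer-edge {g} {g'} h g~g' =
    inj₂ (trans (π₂-⟨⟩ g h) (sym (π₂-⟨⟩ g' h)) , subst₂ (Adj G) (sym (π₁-⟨⟩ g h)) (sym (π₁-⟨⟩ g' h)) g~g')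

  open WeakHomomorphism (G □ H) G π₁ π₁-edge renaming (contract-isPath to contract₁-isPath)
  open WeakHomomorphism (G □ H) H π₂ π₂-edge renaming (contract-isPath to contract₂-isPath)
  open ComplementaryContractions (G □ H) π₁ π₂ edge-fixes-a-coordinate

  lift-fibre : ∀ g {q h h'} → IsPath H q h h' →
               ∃ λ p → IsPath (G □ H) p ⟨ g , h ⟩ ⟨ g , h' ⟩ × length p ≤ length q
  lift-fibre g {h = h} single = ⟨ g , h ⟩ ∷ [] , single , ≤-refl
  lift-fibre g {h = h} (step h~h' rest) with lift-fibre g rest
  ... | p , walk , short = ⟨ g , h ⟩ ∷ p , step (fibre-edge g h~h') walk , s≤s short

  lift : ∀ {q r g g' h h'} → IsPath G q g g' → IsPath H r h h' →
         ∃ λ p → IsPath (G □ H) p ⟨ g , h ⟩ ⟨ g' , h' ⟩ × suc (length p) ≤ length q + length r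
  lift {g = g} single walkH with lift-fibre g walkH
  ... | p , walk , short = p , walk , s≤s short
  lift {h = h} (step g~g' rest) walkH with lift rest walkH
  ... | p , walk , short = _ ∷ p , step (layer-edge h g~g') walk , s≤s short

  -- (1) The π₁-contraction of a geodesic of G □ H is a geodesic of G: a
  -- shorter walk of G, combined with the π₂-contraction, would lift to a walk
  -- of G □ H shorter than the geodesic.
  contract-geodesic : ∀ {p a b} → IsGeodesic (G □ H) p a b → IsGeodesic G (contract π₁ p) (π₁ a) (π₁ b)
  contract-geodesic {p} {a} {b} (walk , minimal) = contract₁-isPath walk , shortest
    where
    shortest : ∀ q → IsPath G q (π₁ a) (π₁ b) → length (contract π₁ p) ≤ length q
    shortest q walkG with lift walkG (contract₂-isPath walk)
    ... | r , walkR , shortR =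
      +-cancelʳ-≤ (length (contract π₂ p)) (length (contract π₁ p)) (length q) (begin
        length (contract π₁ p) + length (contract π₂ p) ≤⟨ contract-length walk ⟩
        suc (length p)                                  ≤⟨ s≤s (minimal r (subst₂ (IsPath (G □ H) r) (⟨π₁,π₂⟩ a) (⟨π₁,π₂⟩ b) walkR)) ⟩
        suc (length r)                                  ≤⟨ shortR ⟩
        length q + length (contract π₂ p)               ∎)
      where open ≤-Reasoning

  layer-∈-contract : ∀ {w h p} → ⟨ w , h ⟩ ∈ₗ p → w ∈ₗ contract π₁ p
  layer-∈-contract {w} {h} {p} w∈p = subst (_∈ₗ contract π₁ p) (π₁-⟨⟩ w h) (∈-contract π₁ p w∈p)

  ∈-projG⁺ : ∀ {X g h} → ⟨ g , h ⟩ ∈ X → g ∈ projG G H X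
  ∈-projG⁺ {X} {g} {h} gh∈X =
    lookup⇒[]= g _ (trans (lookup∘tabulate _ g) (dec-true (any? λ h → ⟨ g , h ⟩ ∈? X) (h , gh∈X)))

  ∈-projG⁻ : ∀ {X g} → g ∈ projG G H X → ∃ λ h → ⟨ g , h ⟩ ∈ X
  ∈-projG⁻ {X} {g} g∈pX
    with any? (λ h → ⟨ g , h ⟩ ∈? X) | trans (sym (lookup∘tabulate _ g)) ([]=⇒lookup g∈pX)
  ... | yes found | _  = found
  ... | no _      | ()

  π₁∈projG : ∀ {X a} → a ∈ X → π₁ a ∈ projG G H X
  π₁∈projG {X} {a} a∈X = ∈-projG⁺ (subst (_∈ X) (sym (⟨π₁,π₂⟩ a)) a∈X)

  projG⊆image : ∀ X → projG G H X ⊆ image π₁ X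
  projG⊆image X g∈pX with ∈-projG⁻ g∈pX
  ... | h , gh∈X = subst (_∈ image π₁ X) (π₁-⟨⟩ _ h) (∈-image π₁ X gh∈X)

  ∣projG∣≤ : ∀ X → ∣ projG G H X ∣ ≤ ∣ X ∣
  ∣projG∣≤ X = ≤-trans (p⊆q⇒∣p∣≤∣q∣ (projG⊆image X)) (∣image∣≤ π₁ X)

  full-projG⇒injective : ∀ X → ∣ X ∣ ≤ ∣ projG G H X ∣ → InjectiveOn π₁ X
  full-projG⇒injective X full = full-image⇒injective π₁ X (≤-trans full (p⊆q⇒∣p∣≤∣q∣ (projG⊆image X)))

  -- (2) The projection of a strong geodetic set of G □ H is geodetic in G:
  -- the vertex (w , h₀) is in S or on a chosen geodesic, whose π₁-contraction
  -- is a geodesic of G through w.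
  projG-geodetic : ∀ {S} → V H → IsStrongGeodeticSet (G □ H) S → IsGeodeticSet G (projG G H S)
  projG-geodetic h₀ (P , P-geodesic , P-covers) w with P-covers ⟨ w , h₀ ⟩
  ... | inj₁ wh₀∈S = w , w , ∈-projG⁺ wh₀∈S , ∈-projG⁺ wh₀∈S , w ∷ [] , trivial-geodesic w , here refl
  ... | inj₂ (x , y , x∈S , y∈S , x<y , wh₀∈P) =
    π₁ x , π₁ y , π₁∈projG x∈S , π₁∈projG y∈S ,
    contract π₁ (P x y) , contract-geodesic (P-geodesic x y x∈S y∈S x<y) , layer-∈-contract wh₀∈P

  choose-fibre : Subset (n (G □ H)) → V H → V G → V H
  choose-fibre S h₀ g with any? (λ h → ⟨ g , h ⟩ ∈? S)
  ... | yes (h , _) = h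
  ... | no _        = h₀

  choose-fibre-∈ : ∀ {S} h₀ {g} → g ∈ projG G H S → ⟨ g , choose-fibre S h₀ g ⟩ ∈ S
  choose-fibre-∈ {S} h₀ {g} g∈pS with any? (λ h → ⟨ g , h ⟩ ∈? S)
  ... | yes (_ , gh∈S) = gh∈S
  ... | no  ∄h         = ⊥-elim (∄h (∈-projG⁻ g∈pS))

  -- (4) If π₁ is injective on a strong geodetic set S, then p_G(S) is strong
  -- geodetic: each g ∈ p_G(S) has the unique preimage (g , choose-fibre g) in
  -- S, and the pair {g , g'} uses the contraction of the geodesic chosen for
  -- the preimage pair.
  projG-strong : ∀ {S} → V H → IsStrongGeodeticSet (G □ H) S → InjectiveOn π₁ S →
                 IsStrongGeodeticSet G (projG G H S)
  projG-strong {S} h₀ (P , P-geodesic , P-covers) injective = Q , Q-geodesic , Q-covers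
    where
    preimage : V G → V (G □ H)
    preimage g = ⟨ g , choose-fibre S h₀ g ⟩

    preimage-π₁ : ∀ {x} → x ∈ S → preimage (π₁ x) ≡ x
    preimage-π₁ x∈S = injective (choose-fibre-∈ h₀ (π₁∈projG x∈S)) x∈S (π₁-⟨⟩ _ _)

    Q : V G → V G → List (V G)
    Q g g' = contract π₁ (P (preimage g) (preimage g'))

    Q-geodesic : ∀ g g' → g ∈ projG G H S → g' ∈ projG G H S → g Fin.< g' → IsGeodesic G (Q g g') g g'
    Q-geodesic g g' g∈pS g'∈pS g<g' =
      subst₂ (IsGeodesic G (Q g g')) (π₁-⟨⟩ g _) (π₁-⟨⟩ g' _)
        (contract-geodesic (P-geodesic _ _ (choose-fibre-∈ h₀ g∈pS) (choose-fibre-∈ h₀ g'∈pS)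
                                        (combine-monoˡ-< _ _ g<g')))

    Q-covers : ∀ w → w ∈ projG G H S ⊎
               (∃ λ g → ∃ λ g' → g ∈ projG G H S × g' ∈ projG G H S × g Fin.< g' × w ∈ₗ Q g g')
    Q-covers w with P-covers ⟨ w , h₀ ⟩
    ... | inj₁ wh₀∈S = inj₁ (∈-projG⁺ wh₀∈S)
    ... | inj₂ (x , y , x∈S , y∈S , x<y , wh₀∈P) with <-cmp (π₁ x) (π₁ y)
    ...   | tri< π₁x<π₁y _ _ =
      inj₂ (π₁ x , π₁ y , π₁∈projG x∈S , π₁∈projG y∈S , π₁x<π₁y ,
            subst₂ (λ s t → w ∈ₗ contract π₁ (P s t)) (sym (preimage-π₁ x∈S)) (sym (preimage-π₁ y∈S))
                   (layer-∈-contract wh₀∈P))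
    ...   | tri≈ _ π₁x≡π₁y _ = ⊥-elim (<⇒≢ x<y (injective x∈S y∈S π₁x≡π₁y))
    ...   | tri> _ _ π₁y<π₁x = ⊥-elim (<-asym x<y (π₁-<⇒< π₁y<π₁x))

sgSet-size : ∀ {G S k} → IsSgSet G S → SgNumber G k → ∣ S ∣ ≡ k
sgSet-size (S-strong , S-minimal) (T , (T-strong , T-minimal) , ∣T∣≡k) =
  trans (≤-antisym (S-minimal T T-strong) (T-minimal _ S-strong)) ∣T∣≡k

size-sgSet : ∀ {G T k} → IsStrongGeodeticSet G T → SgNumber G k → ∣ T ∣ ≡ k → IsSgSet G T
size-sgSet T-strong (S , (_ , S-minimal) , ∣S∣≡k) ∣T∣≡k =
  T-strong , λ U U-strong → subst (_≤ ∣ U ∣) (trans ∣S∣≡k (sym ∣T∣≡k)) (S-minimal U U-strong)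

proposition6p4 : (G H : Graph) → IsSimple G → IsSimple H → Connected G → Connected H →
                   GeneralizedGeodetic G →
                   (∃ λ k → SgNumber (G □ H) k × SgNumber G k) →
                   (S : Subset (n (G □ H))) → IsSgSet (G □ H) S →
                   ∣ projG G H S ∣ ≡ ∣ S ∣ × IsSgSet G (projG G H S)
proposition6p4 G H _ _ _ (h₀ , _) (g-G , (_ , _ , _ , geodetic-minimal) , (T , T-sg , ∣T∣≡g-G))
               (k , sg-product , sg-G) S S-sg@(S-strong , _) =
  ∣pS∣≡∣S∣ , size-sgSet pS-strong sg-G (trans ∣pS∣≡∣S∣ ∣S∣≡k)
  where
  open Product G H
  ∣S∣≡k : ∣ S ∣ ≡ k
  ∣S∣≡k = sgSet-size S-sg sg-product
  g-G≡∣S∣ : g-G ≡ ∣ S ∣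
  g-G≡∣S∣ = trans (sym ∣T∣≡g-G) (trans (sgSet-size T-sg sg-G) (sym ∣S∣≡k))
  ∣S∣≤∣pS∣ : ∣ S ∣ ≤ ∣ projG G H S ∣
  ∣S∣≤∣pS∣ = subst (_≤ ∣ projG G H S ∣) g-G≡∣S∣ (geodetic-minimal _ (projG-geodetic h₀ S-strong))
  ∣pS∣≡∣S∣ : ∣ projG G H S ∣ ≡ ∣ S ∣
  ∣pS∣≡∣S∣ = ≤-antisym (∣projG∣≤ S) ∣S∣≤∣pS∣
  pS-strong : IsStrongGeodeticSet G (projG G H S)
  pS-strong = projG-strong h₀ S-strong (full-projG⇒injective S ∣S∣≤∣pS∣)
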